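{- Let $F$ be a graph of order $n\ge 2$. Then: (i) for every integer $s>(n-1)^2$, the complete graph $K_s$ is not $F$-WORM colorable; (ii) for every integer $s$ with $1\le s\le (n-1)^2$, $K_s$ is $F$-WORM colorable and $W^-(K_s,F)=\lceil s/(n-1)\rceil$; (iii) in every $F$-WORM coloring of $K_{(n-1)^2}$ there are exactly $n-1$ color classes, each of size $n-1$; (iv) in every $F$-WORM coloring of $K_{(n-1)^2-1}$ there are exactly $n-1$ color classes, one of which has $n-2$ vertices and the other $n-2$ of which have $n-1$ vertices each.
   Context: All graphs are finite and simple. For graphs $F$ and $G$, an $F$-WORM coloring of $G$ is an assignment of colors to the vertices of $G$ such that no subgraph of $G$ isomorphic to $F$ is monochromatic (all its vertices have the same color) or rainbow (its vertices have pairwise distinct colors). $G$ is $F$-WORM colorable if it has such a coloring, and then $W^-(G,F)$ is the minimum number of colors in an $F$-WORM coloring of $G$. A color class is the set of vertices receiving a given color. -}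

module Defs where

open import Data.Nat using (ℕ; zero; suc; _+_; _/_; _≤_; _<_; _≤?_)
open import Data.Fin using (Fin; _≟_)
open import Data.Bool using (Bool; true; false; not)
open import Data.List using (length; filter)
open import Data.List.Base using (allFin)
open import Data.Product using (Σ; _×_; ∃)
open import Relation.Nullary using (¬_; Dec)
open import Relation.Nullary.Decidable using (⌊_⌋)
open import Relation.Binary.PropositionalEquality using (_≡_)

record Graph : Set where
  field
    order      : ℕ
    adj        : Fin order → Fin order → Bool
    adj-sym    : ∀ u v → adj u v ≡ adj v u
    adj-irrefl : ∀ u → adj u u ≡ false
open Graph public

K : ℕ → Graph
K s = record
  { order = s
  ; adj = λ u v → not ⌊ u ≟ v ⌋
  ; adj-sym = sym'
  ; adj-irrefl = irr
  }
  where
  open import Relation.Binary.PropositionalEquality using (refl; sym)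
  open import Relation.Nullary using (yes; no)
  sym' : ∀ (u v : Fin s) → not ⌊ u ≟ v ⌋ ≡ not ⌊ v ≟ u ⌋
  sym' u v with u ≟ v | v ≟ u
  ... | yes _ | yes _ = refl
  ... | no _  | no _  = refl
  ... | yes p | no q  = Data.Empty.⊥-elim (q (sym p))
    where import Data.Empty
  ... | no p  | yes q = Data.Empty.⊥-elim (p (sym q))
    where import Data.Empty
  irr : ∀ (u : Fin s) → not ⌊ u ≟ u ⌋ ≡ false
  irr u with u ≟ u
  ... | yes _ = refl
  ... | no p  = Data.Empty.⊥-elim (p refl)
    where import Data.Empty

-- A subgraph of G isomorphic to F, given by an injective edge-preserving
-- map V(F) → V(G) (the copy is the image with the image edges).
record Copy (F G : Graph) : Set where
  field
    emb     : Fin (order F) → Fin (order G)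
    inj     : ∀ u v → emb u ≡ emb v → u ≡ v
    adj-pre : ∀ u v → adj F u v ≡ true → adj G (emb u) (emb v) ≡ true
open Copy public

Coloring : Graph → ℕ → Set
Coloring G k = Fin (order G) → Fin k

Monochromatic : ∀ {F G k} → Coloring G k → Copy F G → Set
Monochromatic c φ = ∀ u v → c (emb φ u) ≡ c (emb φ v)

Rainbow : ∀ {F G k} → Coloring G k → Copy F G → Set
Rainbow c φ = ∀ u v → c (emb φ u) ≡ c (emb φ v) → u ≡ v

IsWORM : (G F : Graph) {k : ℕ} → Coloring G k → Set
IsWORM G F c = ∀ (φ : Copy F G) → ¬ Monochromatic c φ × ¬ Rainbow c φ

WORMColorable : (G F : Graph) → Set
WORMColorable G F = Σ ℕ λ k → Σ (Coloring G k) λ c → IsWORM G F c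

-- W⁻(G,F) = w : w colors suffice, and every F-WORM coloring uses
-- (a palette of) at least w colors.
IsWminus : (G F : Graph) → ℕ → Set
IsWminus G F w =
  Σ (Coloring G w) (λ c → IsWORM G F c) ×
  (∀ k (c : Coloring G k) → IsWORM G F c → w ≤ k)

classSize : (G : Graph) {k : ℕ} → Coloring G k → Fin k → ℕ
classSize G c j = length (filter (λ v → c v ≟ j) (allFin (order G)))

numClasses : (G : Graph) {k : ℕ} → Coloring G k → ℕ
numClasses G {k} c = length (filter (λ j → 1 ≤? classSize G c j) (allFin k))

-- Ceiling division ⌈ s / d ⌉ (d > 0); value 0 for d = 0 (unused).
ceilDiv : ℕ → ℕ → ℕ
ceilDiv s zero    = 0
ceilDiv s (suc d) = (s + d) / suc d

module Submission where

-- Write n = order F = M + 1.  Any n distinct vertices of a complete graph K_s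
-- span a copy of F, so an F-WORM colouring of K_s has every colour class of
-- size at most M and at most M non-empty classes; conversely a colouring
-- with few colours whose classes are separated by few labels is F-WORM
-- (a pigeonhole criterion valid in every host graph).  Counting the vertices
-- class by class gives the defect identity
--     M · #classes = s + Σ_{non-empty classes j} (M − |class j|),
-- a sum of non-negative defects.  From it: (i) s ≤ M·#classes ≤ M²;
-- (ii) s ≤ M·k for every palette Fin k, so k ≥ ⌈s/M⌉, which the block
-- colouring v ↦ ⌊v/M⌋ attains; (iii) for s = M² there are M classes and the
-- defect vanishes; (iv) for s = M² − 1 and M ≥ 2 there are M classes and the
-- defect is 1, i.e. one class of size M − 1 and all others of size M.

open import Defs
open import Data.Nat using (ℕ; zero; suc; _+_; _*_; _≤_; _<_; _∸_; _^_; _≤?_; z≤n; s≤s; s≤s⁻¹; _/_; _%_; NonZero; >-nonZero)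
open import Data.Nat.Properties hiding (_≟_)
open import Algebra.Properties.CommutativeSemigroup +-commutativeSemigroup using (interchange)
open import Data.Nat.DivMod using (m≡m%n+[m/n]*n; m%n<n; m<n*o⇒m/o<n)
open import Data.Nat.ListAction using (sum)
open import Data.Fin using (Fin; zero; suc; _≟_; toℕ; fromℕ<; inject≤)
open import Data.Fin.Properties using (injective⇒≤; inject≤-injective; fromℕ<-injective; toℕ<n; toℕ-injective)
open import Data.List using (List; []; _∷_; length; filter; map; lookup; allFin)
open import Data.List.Properties using (map-tabulate; map-cong; length-tabulate; filter-accept; filter-reject; length-filter)
import Data.List.Relation.Unary.All as All
open import Data.List.Relation.Unary.AllPairs using (_∷_)
open import Data.List.Relation.Unary.Unique.Propositional using (Unique)
open import Data.List.Relation.Unary.Unique.Propositional.Properties using (filter⁺; allFin⁺)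
open import Data.List.Relation.Unary.Any using (here; there)
open import Data.List.Membership.Propositional using (_∈_)
open import Data.List.Membership.Propositional.Properties using (∈-filter⁺; ∈-filter⁻; ∈-allFin; ∈-lookup)
open import Data.Bool using (true; if_then_else_)
open import Data.Product using (Σ; _×_; _,_; proj₁; proj₂)
open import Data.Empty using (⊥-elim)
open import Function using (_∘_)
open import Relation.Nullary using (¬_; yes; no; does)
open import Relation.Unary using (Decidable)
open import Relation.Binary.PropositionalEquality

module _ {A : Set} where

  sum-zeros : ∀ (xs : List A) → sum (map (λ _ → 0) xs) ≡ 0
  sum-zeros [] = refl
  sum-zeros (_ ∷ xs) = sum-zeros xs

  sum-map-+ : ∀ (f g : A → ℕ) xs → sum (map (λ x → f x + g x) xs) ≡ sum (map f xs) + sum (map g xs)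
  sum-map-+ f g [] = refl
  sum-map-+ f g (x ∷ xs) = trans (cong (f x + g x +_) (sum-map-+ f g xs)) (interchange (f x) (g x) _ _)

  sum-positive-part : ∀ (f : A → ℕ) xs → sum (map f xs) ≡ sum (map f (filter (λ y → 1 ≤? f y) xs))
  sum-positive-part f [] = refl
  sum-positive-part f (x ∷ xs) with 1 ≤? f x
  ... | yes 1≤fx = begin
    f x + sum (map f xs)                                   ≡⟨ cong (f x +_) (sum-positive-part f xs) ⟩
    f x + sum (map f (filter (λ y → 1 ≤? f y) xs))         ≡⟨ cong (sum ∘ map f) (filter-accept (λ y → 1 ≤? f y) 1≤fx) ⟨
    sum (map f (filter (λ y → 1 ≤? f y) (x ∷ xs)))         ∎
    where open ≡-Reasoning
  ... | no 1≰fx = begin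
    f x + sum (map f xs)                                   ≡⟨ cong₂ _+_ (n<1⇒n≡0 (≰⇒> 1≰fx)) (sum-positive-part f xs) ⟩
    sum (map f (filter (λ y → 1 ≤? f y) xs))               ≡⟨ cong (sum ∘ map f) (filter-reject (λ y → 1 ≤? f y) 1≰fx) ⟨
    sum (map f (filter (λ y → 1 ≤? f y) (x ∷ xs)))         ∎
    where open ≡-Reasoning

  -- If f ≤ M everywhere, each entry contributes M = f x + (M ∸ f x).
  complement-sum : ∀ M (f : A → ℕ) → (∀ x → f x ≤ M) → ∀ xs →
    M * length xs ≡ sum (map f xs) + sum (map (λ x → M ∸ f x) xs)
  complement-sum M f f≤M [] = *-zeroʳ M
  complement-sum M f f≤M (x ∷ xs) = begin
    M * suc (length xs)                    ≡⟨ *-suc M (length xs) ⟩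
    M + M * length xs                      ≡⟨ cong₂ _+_ (sym (m+[n∸m]≡n (f≤M x))) (complement-sum M f f≤M xs) ⟩
    (f x + (M ∸ f x)) + (Σf + Σdefect)     ≡⟨ interchange (f x) (M ∸ f x) Σf Σdefect ⟩
    (f x + Σf) + ((M ∸ f x) + Σdefect)     ∎
    where
    open ≡-Reasoning
    Σf = sum (map f xs)
    Σdefect = sum (map (λ x → M ∸ f x) xs)

  ∈⇒≤sum : ∀ (g : A → ℕ) {x xs} → x ∈ xs → g x ≤ sum (map g xs)
  ∈⇒≤sum g {xs = y ∷ ys} (here refl) = m≤m+n (g y) _
  ∈⇒≤sum g {xs = y ∷ ys} (there x∈ys) = ≤-trans (∈⇒≤sum g x∈ys) (m≤n+m _ (g y))

  distinct-∈⇒≤sum : ∀ (g : A → ℕ) {x y xs} → x ∈ xs → y ∈ xs → x ≢ y → g x + g y ≤ sum (map g xs)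
  distinct-∈⇒≤sum g (here refl) (here refl) x≢y = ⊥-elim (x≢y refl)
  distinct-∈⇒≤sum g (here refl) (there y∈) _ = +-monoʳ-≤ _ (∈⇒≤sum g y∈)
  distinct-∈⇒≤sum g {x} {y} {_ ∷ ys} (there x∈) (here refl) _ =
    subst (_≤ g y + sum (map g ys)) (+-comm (g y) (g x)) (+-monoʳ-≤ (g y) (∈⇒≤sum g x∈))
  distinct-∈⇒≤sum g {xs = z ∷ _} (there x∈) (there y∈) x≢y =
    ≤-trans (distinct-∈⇒≤sum g x∈ y∈ x≢y) (m≤n+m _ (g z))

  positive-sum⇒∈ : ∀ (g : A → ℕ) xs → 1 ≤ sum (map g xs) → Σ A λ x → x ∈ xs × 1 ≤ g x
  positive-sum⇒∈ g (x ∷ xs) 1≤sum with 1 ≤? g x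
  ... | yes 1≤gx = x , here refl , 1≤gx
  ... | no 1≰gx with positive-sum⇒∈ g xs (subst (λ z → 1 ≤ z + sum (map g xs)) (n<1⇒n≡0 (≰⇒> 1≰gx)) 1≤sum)
  ...   | y , y∈xs , 1≤gy = y , there y∈xs , 1≤gy

δ : ∀ {k} → Fin k → Fin k → ℕ
δ x j = if does (x ≟ j) then 1 else 0

sum-allFin-suc : ∀ {k} (g : Fin (suc k) → ℕ) → sum (map g (allFin (suc k))) ≡ g zero + sum (map (g ∘ suc) (allFin k))
sum-allFin-suc {k} g = cong (λ ys → g zero + sum ys) (trans (map-tabulate suc g) (sym (map-tabulate (λ j → j) (g ∘ suc))))

δ-suc : ∀ {k} (x j : Fin k) → δ (suc x) (suc j) ≡ δ x j
δ-suc x j with x ≟ j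
... | yes refl = refl
... | no _ = refl

δ-sum : ∀ {k} (x : Fin k) → sum (map (δ x) (allFin k)) ≡ 1
δ-sum {suc k} zero = trans (sum-allFin-suc {k} (δ zero)) (cong suc (sum-zeros (allFin k)))
δ-sum {suc k} (suc x) = begin
  sum (map (δ (suc x)) (allFin (suc k)))  ≡⟨ sum-allFin-suc {k} (δ (suc x)) ⟩
  sum (map (δ (suc x) ∘ suc) (allFin k))  ≡⟨ cong sum (map-cong (δ-suc x) (allFin k)) ⟩
  sum (map (δ x) (allFin k))              ≡⟨ δ-sum x ⟩
  1                                       ∎
  where open ≡-Reasoning

classes-partition : ∀ {A : Set} {k} (c : A → Fin k) vs →
  sum (map (λ j → length (filter (λ v → c v ≟ j) vs)) (allFin k)) ≡ length vs
classes-partition {k = k} c [] = sum-zeros (allFin k)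
classes-partition {k = k} c (v ∷ vs) = begin
  sum (map (λ j → size j (v ∷ vs)) (allFin k))           ≡⟨ cong sum (map-cong peel (allFin k)) ⟩
  sum (map (λ j → δ (c v) j + size j vs) (allFin k))     ≡⟨ sum-map-+ (δ (c v)) (λ j → size j vs) (allFin k) ⟩
  sum (map (δ (c v)) (allFin k)) + sum (map (λ j → size j vs) (allFin k))
                                                        ≡⟨ cong₂ _+_ (δ-sum (c v)) (classes-partition c vs) ⟩
  suc (length vs)                                       ∎
  where
  open ≡-Reasoning
  size : Fin k → List _ → ℕ
  size j ws = length (filter (λ w → c w ≟ j) ws)
  peel : ∀ j → size j (v ∷ vs) ≡ δ (c v) j + size j vs
  peel j with c v ≟ j
  ... | yes _ = refl
  ... | no _ = refl

classes-total : ∀ (G : Graph) {k} (c : Coloring G k) → sum (map (classSize G c) (allFin k)) ≡ order G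
classes-total G c = trans (classes-partition c (allFin (order G))) (length-tabulate (λ v → v))

unique-lookup-injective : ∀ {A : Set} {xs : List A} → Unique xs → ∀ i j → lookup xs i ≡ lookup xs j → i ≡ j
unique-lookup-injective (_ ∷ _) zero zero _ = refl
unique-lookup-injective (x∉xs ∷ _) zero (suc j) x≡ = ⊥-elim (All.lookup x∉xs (∈-lookup j) x≡)
unique-lookup-injective (x∉xs ∷ _) (suc i) zero ≡x = ⊥-elim (All.lookup x∉xs (∈-lookup i) (sym ≡x))
unique-lookup-injective (_ ∷ unique) (suc i) (suc j) eq = cong suc (unique-lookup-injective unique i j eq)

filter-injection : ∀ {s n} {P : Fin s → Set} (P? : Decidable P) → n ≤ length (filter P? (allFin s)) →
  Σ (Fin n → Fin s) λ e → (∀ u v → e u ≡ e v → u ≡ v) × (∀ u → P (e u))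
filter-injection {s} {P = P} P? n≤ = e , e-injective , e-satisfies
  where
  e = λ u → lookup (filter P? (allFin s)) (inject≤ u n≤)
  e-injective : ∀ u v → e u ≡ e v → u ≡ v
  e-injective u v eq = inject≤-injective n≤ n≤ u v (unique-lookup-injective (filter⁺ P? (allFin⁺ s)) _ _ eq)
  e-satisfies : ∀ u → P (e u)
  e-satisfies u = proj₂ (∈-filter⁻ P? {xs = allFin s} (∈-lookup (inject≤ u n≤)))

adjacent⇒distinct : ∀ (G : Graph) {u v} → adj G u v ≡ true → u ≢ v
adjacent⇒distinct G {u} uv refl with trans (sym uv) (adj-irrefl G u)
... | ()

distinct⇒adjacent : ∀ {s} (a b : Fin s) → a ≢ b → adj (K s) a b ≡ true
distinct⇒adjacent a b a≢b with a ≟ b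
... | yes a≡b = ⊥-elim (a≢b a≡b)
... | no _ = refl

complete-copy : ∀ {F s} (e : Fin (order F) → Fin s) → (∀ u v → e u ≡ e v → u ≡ v) → Copy F (K s)
complete-copy {F} e e-injective = record
  { emb = e
  ; inj = e-injective
  ; adj-pre = λ u v uv → distinct⇒adjacent (e u) (e v) (adjacent⇒distinct F uv ∘ e-injective u v)
  }

-- An F-WORM colouring of K_s has no class of order F vertices: they would
-- span a monochromatic copy of F.
worm⇒class<order : ∀ {F s k} (c : Coloring (K s) k) → IsWORM (K s) F c → ∀ j → classSize (K s) c j < order F
worm⇒class<order c worm j = ≰⇒> λ big →
  let (e , e-injective , e-coloured) = filter-injection (λ v → c v ≟ j) big
  in proj₁ (worm (complete-copy e e-injective)) (λ u v → trans (e-coloured u) (sym (e-coloured v)))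

class-representative : ∀ {s k} (c : Coloring (K s) k) {j} → 1 ≤ classSize (K s) c j → Σ (Fin s) λ v → c v ≡ j
class-representative c {j} 1≤size =
  let (e , _ , e-coloured) = filter-injection (λ v → c v ≟ j) 1≤size in e zero , e-coloured zero

-- An F-WORM colouring of K_s has fewer than order F classes: one vertex
-- from each of order F classes would span a rainbow copy of F.
worm⇒classes<order : ∀ {F s k} (c : Coloring (K s) k) → IsWORM (K s) F c → numClasses (K s) c < order F
worm⇒classes<order {s = s} c worm = ≰⇒> λ big →
  let (g , g-injective , g-used) = filter-injection (λ j → 1 ≤? classSize (K s) c j) big
      r = λ u → proj₁ (class-representative c (g-used u))
      r-coloured = λ u → proj₂ (class-representative c (g-used u))
      rainbow = λ u v c≡ → g-injective u v (trans (sym (r-coloured u)) (trans c≡ (r-coloured v)))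
  in proj₂ (worm (complete-copy r (λ u v → rainbow u v ∘ cong c))) rainbow

pigeonhole⇒worm : ∀ {G F k m} (c : Coloring G k) (label : Fin (order G) → Fin m) →
  k < order F → m < order F → (∀ v w → c v ≡ c w → label v ≡ label w → v ≡ w) → IsWORM G F c
pigeonhole⇒worm c label k<n m<n separates φ = not-monochromatic , not-rainbow
  where
  not-monochromatic : ¬ Monochromatic c φ
  not-monochromatic mono = <⇒≱ m<n (injective⇒≤ {f = label ∘ emb φ} λ {u} {v} eq → inj φ u v (separates _ _ (mono u v) eq))
  not-rainbow : ¬ Rainbow c φ
  not-rainbow rainbow = <⇒≱ k<n (injective⇒≤ {f = c ∘ emb φ} λ {u} {v} → rainbow u v)

usedColours : (G : Graph) {k : ℕ} → Coloring G k → List (Fin k)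
usedColours G {k} c = filter (λ j → 1 ≤? classSize G c j) (allFin k)

used-member : ∀ (G : Graph) {k} (c : Coloring G k) {j} → 1 ≤ classSize G c j → j ∈ usedColours G c
used-member G c {j} 1≤size = ∈-filter⁺ (λ j → 1 ≤? classSize G c j) (∈-allFin j) 1≤size

classes≤palette : ∀ (G : Graph) {k} (c : Coloring G k) → numClasses G c ≤ k
classes≤palette G {k} c =
  subst (numClasses G c ≤_) (length-tabulate (λ j → j)) (length-filter (λ j → 1 ≤? classSize G c j) (allFin k))

defect : (G : Graph) {k : ℕ} → ℕ → Coloring G k → ℕ
defect G M c = sum (map (λ j → M ∸ classSize G c j) (usedColours G c))

defect-identity : ∀ (G : Graph) {k} M (c : Coloring G k) → (∀ j → classSize G c j ≤ M) →
  M * numClasses G c ≡ order G + defect G M c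
defect-identity G {k} M c size≤M = begin
  M * numClasses G c                                           ≡⟨ complement-sum M size size≤M (usedColours G c) ⟩
  sum (map size (usedColours G c)) + defect G M c              ≡⟨ cong (_+ defect G M c) (sum-positive-part size (allFin k)) ⟨
  sum (map size (allFin k)) + defect G M c                     ≡⟨ cong (_+ defect G M c) (classes-total G c) ⟩
  order G + defect G M c                                       ∎
  where
  open ≡-Reasoning
  size = classSize G c

size-from-shortfall : ∀ {size M d} → size ≤ M → M ∸ size ≡ d → size ≡ M ∸ d
size-from-shortfall {size} {M} size≤M refl = sym (m∸[m∸n]≡n size≤M)

zero-defect : ∀ (G : Graph) {k} M (c : Coloring G k) → (∀ j → classSize G c j ≤ M) → defect G M c ≡ 0 →
  ∀ j → 1 ≤ classSize G c j → classSize G c j ≡ M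
zero-defect G M c size≤M defect≡0 j 1≤size = size-from-shortfall (size≤M j)
  (n≤0⇒n≡0 (subst (M ∸ classSize G c j ≤_) defect≡0
    (∈⇒≤sum (λ j → M ∸ classSize G c j) (used-member G c 1≤size))))

unit-defect : ∀ (G : Graph) {k} M (c : Coloring G k) → (∀ j → classSize G c j ≤ M) → defect G M c ≡ 1 →
  Σ (Fin k) λ j → classSize G c j ≡ M ∸ 1 ×
    (∀ j′ → j′ ≢ j → 1 ≤ classSize G c j′ → classSize G c j′ ≡ M)
unit-defect G M c size≤M defect≡1 = j , size-from-shortfall (size≤M j) shortfall≡1 , others
  where
  shortfall = λ j → M ∸ classSize G c j
  witness = positive-sum⇒∈ shortfall (usedColours G c) (≤-reflexive (sym defect≡1))
  j = proj₁ witness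
  shortfall≡1 : shortfall j ≡ 1
  shortfall≡1 = ≤-antisym (subst (shortfall j ≤_) defect≡1 (∈⇒≤sum shortfall (proj₁ (proj₂ witness))))
                          (proj₂ (proj₂ witness))
  others : ∀ j′ → j′ ≢ j → 1 ≤ classSize G c j′ → classSize G c j′ ≡ M
  others j′ j′≢j 1≤size = size-from-shortfall (size≤M j′) (n≤0⇒n≡0 (+-cancelʳ-≤ 1 (shortfall j′) 0
    (subst₂ (λ a b → shortfall j′ + a ≤ b) shortfall≡1 defect≡1
      (distinct-∈⇒≤sum shortfall (used-member G c 1≤size) (proj₁ (proj₂ witness)) j′≢j))))

ceilDiv-least : ∀ {s M N} → 1 ≤ M → s ≤ M * N → ceilDiv s M ≤ N
ceilDiv-least {s} {suc m} {N} _ s≤MN = s≤s⁻¹ (m<n*o⇒m/o<n (begin-strict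
  s + m                  <⟨ +-monoʳ-< s (n<1+n m) ⟩
  s + suc m              ≤⟨ +-monoˡ-≤ (suc m) s≤MN ⟩
  suc m * N + suc m      ≡⟨ cong (_+ suc m) (*-comm (suc m) N) ⟩
  N * suc m + suc m      ≡⟨ +-comm (N * suc m) (suc m) ⟩
  suc N * suc m          ∎))
  where open ≤-Reasoning

ceilDiv-covers : ∀ s m → s ≤ ceilDiv s (suc m) * suc m
ceilDiv-covers s m = +-cancelˡ-≤ m _ _ (begin
  m + s                                  ≡⟨ +-comm m s ⟩
  s + m                                  ≡⟨ m≡m%n+[m/n]*n (s + m) (suc m) ⟩
  (s + m) % suc m + q * suc m            ≤⟨ +-monoˡ-≤ (q * suc m) (s≤s⁻¹ (m%n<n (s + m) (suc m))) ⟩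
  m + q * suc m                          ∎)
  where
  open ≤-Reasoning
  q = ceilDiv s (suc m)

div-mod-injective : ∀ {a b d} .{{_ : NonZero d}} → a / d ≡ b / d → a % d ≡ b % d → a ≡ b
div-mod-injective {a} {b} {d} a/d≡b/d a%d≡b%d = begin
  a                    ≡⟨ m≡m%n+[m/n]*n a d ⟩
  a % d + a / d * d    ≡⟨ cong₂ (λ r q → r + q * d) a%d≡b%d a/d≡b/d ⟩
  b % d + b / d * d    ≡⟨ m≡m%n+[m/n]*n b d ⟨
  b                    ∎
  where open ≡-Reasoning

block-colouring : ∀ {M} s → 1 ≤ M → Coloring (K s) (ceilDiv s M)
block-colouring {suc m} s _ v = fromℕ< (m<n*o⇒m/o<n (<-≤-trans (toℕ<n v) (ceilDiv-covers s m)))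

block-position : ∀ {M} s → 1 ≤ M → Fin s → Fin M
block-position {suc m} s _ v = fromℕ< (m%n<n (toℕ v) (suc m))

block-separates : ∀ {M} s (1≤M : 1 ≤ M) v w → block-colouring s 1≤M v ≡ block-colouring s 1≤M w →
  block-position s 1≤M v ≡ block-position s 1≤M w → v ≡ w
block-separates {suc m} s _ v w same-block same-position = toℕ-injective
  (div-mod-injective (fromℕ<-injective _ _ _ _ same-block) (fromℕ<-injective _ _ _ _ same-position))

square : ∀ m → m ^ 2 ≡ m * m
square m = cong (m *_) (*-identityʳ m)

module WORMColouringsOfK (F : Graph) (M : ℕ) (n≡1+M : order F ≡ suc M) where

  below-order : ∀ {x} → x ≤ M → x < order F
  below-order x≤M = subst (_ <_) (sym n≡1+M) (s≤s x≤M)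

  class≤M : ∀ {s k} (c : Coloring (K s) k) → IsWORM (K s) F c → ∀ j → classSize (K s) c j ≤ M
  class≤M c worm j = s≤s⁻¹ (subst (_ <_) n≡1+M (worm⇒class<order c worm j))

  classes≤M : ∀ {s k} (c : Coloring (K s) k) → IsWORM (K s) F c → numClasses (K s) c ≤ M
  classes≤M c worm = s≤s⁻¹ (subst (_ <_) n≡1+M (worm⇒classes<order c worm))

  worm-defect : ∀ {s k} (c : Coloring (K s) k) → IsWORM (K s) F c → M * numClasses (K s) c ≡ s + defect (K s) M c
  worm-defect {s} c worm = defect-identity (K s) M c (class≤M c worm)

  order≤classes : ∀ {s k} (c : Coloring (K s) k) → IsWORM (K s) F c → s ≤ M * numClasses (K s) c
  order≤classes {s} c worm = subst (s ≤_) (sym (worm-defect c worm)) (m≤m+n s _)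

  no-worm-beyond : ∀ s → M ^ 2 < s → ¬ WORMColorable (K s) F
  no-worm-beyond s M²<s (k , c , worm) = <⇒≱ M²<s (begin
    s                         ≤⟨ order≤classes c worm ⟩
    M * numClasses (K s) c    ≤⟨ *-monoʳ-≤ M (classes≤M c worm) ⟩
    M * M                     ≡⟨ square M ⟨
    M ^ 2                     ∎)
    where open ≤-Reasoning

  worm-number : 1 ≤ M → ∀ s → s ≤ M ^ 2 → WORMColorable (K s) F × IsWminus (K s) F (ceilDiv s M)
  worm-number 1≤M s s≤M² = (ceilDiv s M , block , block-worm) , (block , block-worm) , least
    where
    block = block-colouring s 1≤M
    block-worm : IsWORM (K s) F block
    block-worm = pigeonhole⇒worm block (block-position s 1≤M)
      (below-order (ceilDiv-least 1≤M (subst (s ≤_) (square M) s≤M²))) (below-order ≤-refl)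
      (block-separates s 1≤M)
    least : ∀ k (c : Coloring (K s) k) → IsWORM (K s) F c → ceilDiv s M ≤ k
    least k c worm = ceilDiv-least 1≤M (≤-trans (order≤classes c worm) (*-monoʳ-≤ M (classes≤palette (K s) c)))

  extremal : 1 ≤ M → ∀ k (c : Coloring (K (M ^ 2)) k) → IsWORM (K (M ^ 2)) F c →
    numClasses (K (M ^ 2)) c ≡ M × (∀ j → 1 ≤ classSize (K (M ^ 2)) c j → classSize (K (M ^ 2)) c j ≡ M)
  extremal 1≤M k c worm = classes≡M , zero-defect (K (M ^ 2)) M c (class≤M c worm) defect≡0
    where
    classes = numClasses (K (M ^ 2)) c
    M²+defect≤M² : M ^ 2 + defect (K (M ^ 2)) M c ≤ M ^ 2 + 0
    M²+defect≤M² = begin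
      M ^ 2 + defect (K (M ^ 2)) M c    ≡⟨ worm-defect c worm ⟨
      M * classes                       ≤⟨ *-monoʳ-≤ M (classes≤M c worm) ⟩
      M * M                             ≡⟨ trans (+-identityʳ (M ^ 2)) (square M) ⟨
      M ^ 2 + 0                         ∎
      where open ≤-Reasoning
    defect≡0 : defect (K (M ^ 2)) M c ≡ 0
    defect≡0 = n≤0⇒n≡0 (+-cancelˡ-≤ (M ^ 2) _ _ M²+defect≤M²)
    classes≡M : classes ≡ M
    classes≡M = *-cancelˡ-≡ classes M M {{>-nonZero 1≤M}} (begin
      M * classes                       ≡⟨ worm-defect c worm ⟩
      M ^ 2 + defect (K (M ^ 2)) M c    ≡⟨ cong (M ^ 2 +_) defect≡0 ⟩
      M ^ 2 + 0                         ≡⟨ trans (+-identityʳ (M ^ 2)) (square M) ⟩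
      M * M                             ∎)
      where open ≡-Reasoning

  near-extremal : 2 ≤ M → ∀ k (c : Coloring (K (M ^ 2 ∸ 1)) k) → IsWORM (K (M ^ 2 ∸ 1)) F c →
    numClasses (K (M ^ 2 ∸ 1)) c ≡ M ×
    Σ (Fin k) (λ j → classSize (K (M ^ 2 ∸ 1)) c j ≡ M ∸ 1 ×
      (∀ j′ → j′ ≢ j → 1 ≤ classSize (K (M ^ 2 ∸ 1)) c j′ → classSize (K (M ^ 2 ∸ 1)) c j′ ≡ M))
  near-extremal 2≤M k c worm = classes≡M , unit-defect (K s) M c (class≤M c worm) defect≡1
    where
    s = M ^ 2 ∸ 1
    classes = numClasses (K s) c
    s+1≡M*M : s + 1 ≡ M * M
    s+1≡M*M = trans (m∸n+n≡m (subst (1 ≤_) (sym (square M)) (≤-trans (s≤s z≤n) (*-mono-≤ 2≤M 2≤M)))) (square M)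
    -- With at most M − 1 classes only M² − M < s vertices would fit.
    classes≮M : ¬ classes < M
    classes≮M classes<M = <-irrefl refl (begin-strict
      s + 1                            <⟨ +-monoʳ-< s 2≤M ⟩
      s + M                            ≤⟨ +-monoˡ-≤ M (m≤m+n s (defect (K s) M c)) ⟩
      s + defect (K s) M c + M         ≡⟨ cong (_+ M) (worm-defect c worm) ⟨
      M * classes + M                  ≡⟨ +-comm (M * classes) M ⟩
      M + M * classes                  ≡⟨ *-suc M classes ⟨
      M * suc classes                  ≤⟨ *-monoʳ-≤ M classes<M ⟩
      M * M                            ≡⟨ s+1≡M*M ⟨
      s + 1                            ∎)
      where open ≤-Reasoning
    classes≡M : classes ≡ M
    classes≡M = ≤-antisym (classes≤M c worm) (≮⇒≥ classes≮M)
    defect≡1 : defect (K s) M c ≡ 1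
    defect≡1 = +-cancelˡ-≡ s _ _ (begin
      s + defect (K s) M c             ≡⟨ worm-defect c worm ⟨
      M * classes                      ≡⟨ cong (M *_) classes≡M ⟩
      M * M                            ≡⟨ s+1≡M*M ⟨
      s + 1                            ∎)
      where open ≡-Reasoning

proposition5 : (F : Graph) → 2 ≤ order F →
    (∀ s → (order F ∸ 1) ^ 2 < s → ¬ WORMColorable (K s) F)
    × (∀ s → 1 ≤ s → s ≤ (order F ∸ 1) ^ 2 →
         WORMColorable (K s) F × IsWminus (K s) F (ceilDiv s (order F ∸ 1)))
    × (∀ k (c : Coloring (K ((order F ∸ 1) ^ 2)) k) → IsWORM (K ((order F ∸ 1) ^ 2)) F c →
         numClasses (K ((order F ∸ 1) ^ 2)) c ≡ order F ∸ 1
         × (∀ j → 1 ≤ classSize (K ((order F ∸ 1) ^ 2)) c j →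
              classSize (K ((order F ∸ 1) ^ 2)) c j ≡ order F ∸ 1))
    × (3 ≤ order F →
       ∀ k (c : Coloring (K ((order F ∸ 1) ^ 2 ∸ 1)) k) → IsWORM (K ((order F ∸ 1) ^ 2 ∸ 1)) F c →
         numClasses (K ((order F ∸ 1) ^ 2 ∸ 1)) c ≡ order F ∸ 1
         × Σ (Fin k) (λ j →
             classSize (K ((order F ∸ 1) ^ 2 ∸ 1)) c j ≡ order F ∸ 2
             × (∀ j′ → j′ ≢ j → 1 ≤ classSize (K ((order F ∸ 1) ^ 2 ∸ 1)) c j′ →
                  classSize (K ((order F ∸ 1) ^ 2 ∸ 1)) c j′ ≡ order F ∸ 1)))
proposition5 F 2≤n =
    no-worm-beyond
  , (λ s _ → worm-number 1≤M s)
  , extremal 1≤M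
  , λ 3≤n k c worm →
      let (classes≡M , j , size≡M-1 , others) = near-extremal (∸-monoˡ-≤ 1 3≤n) k c worm
      in classes≡M , j , trans size≡M-1 (∸-+-assoc (order F) 1 1) , others
  where
  M = order F ∸ 1
  n≡1+M : order F ≡ suc M
  n≡1+M = sym (m+[n∸m]≡n (≤-trans (s≤s z≤n) 2≤n))
  1≤M : 1 ≤ M
  1≤M = ∸-monoˡ-≤ 1 2≤n
  open WORMColouringsOfK F M n≡1+M
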